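{- For every integer $n>0$, let $b=\lfloor \log_2 n\rfloor$ and $c=n+1-2^{b}$. Then $a_4(n)=2^{3b}+6c^2\,2^{b}+a_4(c-1)$.
   Context: A P-position of the game of Nim with $k$ piles is a $k$-tuple $(p_1,\dots,p_k)$ of non-negative integers whose nim-sum $p_1\oplus\cdots\oplus p_k$ is $0$, where $\oplus$ denotes bitwise XOR. $a_k(m)$ denotes the number of P-positions with $k$ piles such that every pile has at most $m$ counters, for $m\ge 0$ (so $a_k(0)=1$). -}

module Defs where

open import Data.Nat using (ℕ; zero; suc; _+_; _*_; _≟_)
open import Data.Nat.DivMod using (_/_; _%_)
open import Data.Nat.Induction using (<-wellFounded)
open import Data.Nat.Properties using (≤-refl)
open import Data.Bool using (Bool; true; false; if_then_else_)
open import Data.List using (List; []; _∷_; upTo; concatMap; map; filter; length)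
open import Data.Vec using (Vec; []; _∷_; foldr)
open import Relation.Nullary.Decidable using (does)

-- Bitwise XOR on natural numbers, defined by recursion on the fuel
-- (fuel ≥ max of the arguments suffices, since each step halves them).
xorFuel : ℕ → ℕ → ℕ → ℕ
xorFuel zero    m n = 0
xorFuel (suc f) m n =
  (if does ((m % 2) ≟ (n % 2)) then 0 else 1) + 2 * xorFuel f (m / 2) (n / 2)

infixl 6 _⊕_
_⊕_ : ℕ → ℕ → ℕ
m ⊕ n = xorFuel (m + n) m n

nimSum : ∀ {k} → Vec ℕ k → ℕ
nimSum = foldr _ _⊕_ 0

tuples : (k m : ℕ) → List (Vec ℕ k)
tuples zero    m = [] ∷ []
tuples (suc k) m = concatMap (λ p → map (p ∷_) (tuples k m)) (upTo (suc m))

-- a_k(m): number of P-positions of k-pile Nim with every pile ≤ m.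
a : ℕ → ℕ → ℕ
a k m = length (filter (λ v → nimSum v ≟ 0) (tuples k m))

module Submission where

-- Write each pile p ≤ 2^b + r as p = h·2^b + p′ with a flag h and p′ < 2^b (p′ ≤ r when
-- h is set). As x ⊕ y < 2^b for x, y < 2^b and 2^b ⊕ x = 2^b + x, the nim-sum of a position
-- is (xor of the flags)·2^b ⊕ (nim-sum of the low parts), so a P-position has an even number
-- of flagged piles. With all four flagged, the low parts form an arbitrary P-position with
-- piles ≤ r, counted by a₄(r). Otherwise some unflagged pile ranges over all of [0, 2^b) and
-- is determined by the other three; this gives 2^{3b} positions with no flag and c²·2^b for
-- each of the six pairs of flagged piles, where c = r + 1.

open import Defs
open import Algebra.Bundles using (CommutativeMonoid)
import Algebra.Properties.CommutativeSemigroup as CommutativeSemigroupProperties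
open import Algebra.Structures using (IsCommutativeMonoid)
open import Data.Bool using (Bool; true; false; if_then_else_; _xor_)
open import Data.Fin using (Fin)
import Data.Fin as Fin
open import Data.List using (List; []; _∷_; _++_; length; filter; concatMap; applyUpTo; upTo)
import Data.List as List
open import Data.List.Properties using (length-++; filter-++)
open import Data.Nat hiding (parity)
open import Data.Nat.DivMod
open import Data.Nat.Induction using (<-wellFounded)
open import Data.Nat.Logarithm using (⌊log₂_⌋)
open import Data.Nat.Logarithm.Core using (⌊log2⌋)
open import Data.Nat.Properties
open import Data.Nat.Tactic.RingSolver using (solve-∀)
open import Data.Product using (_×_; _,_; proj₁; proj₂)
open import Data.Vec using (Vec; []; _∷_; foldr′; replicate; map; zipWith; removeAt; lookup)
open import Data.Vec.Relation.Binary.Pointwise.Inductive using (Pointwise; []; _∷_)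
open import Data.Vec.Relation.Unary.All using (All; []; _∷_)
open import Function using (_∘_; id)
open import Induction.WellFounded using (Acc; acc)
open import Level using (0ℓ)
open import Relation.Binary.PropositionalEquality
open import Relation.Binary.PropositionalEquality.Algebra using (isMagma)
open import Relation.Nullary using (yes; no; does; ¬_)
open import Relation.Nullary.Decidable using (dec-true; dec-false)
open import Relation.Unary using (Pred; Decidable)

-- Bitwise xor

bitXor : ℕ → ℕ → ℕ
bitXor i j = if does (i ≟ j) then 0 else 1

bitXor-≡ : ∀ {i j} → i ≡ j → bitXor i j ≡ 0
bitXor-≡ {i} {j} i≡j rewrite dec-true (i ≟ j) i≡j = refl

bitXor-≢ : ∀ {i j} → ¬ i ≡ j → bitXor i j ≡ 1
bitXor-≢ {i} {j} i≢j rewrite dec-false (i ≟ j) i≢j = refl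

bitXor<2 : ∀ i j → bitXor i j < 2
bitXor<2 i j with i ≟ j
... | yes i≡j rewrite bitXor-≡ i≡j = s≤s z≤n
... | no  i≢j rewrite bitXor-≢ i≢j = s≤s (s≤s z≤n)

bitXor-comm : ∀ i j → bitXor i j ≡ bitXor j i
bitXor-comm i j with i ≟ j
... | yes i≡j rewrite bitXor-≡ i≡j | bitXor-≡ (sym i≡j) = refl
... | no  i≢j rewrite bitXor-≢ i≢j | bitXor-≢ (i≢j ∘ sym) = refl

bitXor-identityʳ : ∀ {i} → i < 2 → bitXor i 0 ≡ i
bitXor-identityʳ {0} _ = refl
bitXor-identityʳ {1} _ = refl
bitXor-identityʳ {2+ _} (s≤s (s≤s ()))

bitXor-assoc : ∀ {i j k} → i < 2 → j < 2 → k < 2 →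
               bitXor (bitXor i j) k ≡ bitXor i (bitXor j k)
bitXor-assoc {0} {0} {0} _ _ _ = refl
bitXor-assoc {0} {0} {1} _ _ _ = refl
bitXor-assoc {0} {1} {0} _ _ _ = refl
bitXor-assoc {0} {1} {1} _ _ _ = refl
bitXor-assoc {1} {0} {0} _ _ _ = refl
bitXor-assoc {1} {0} {1} _ _ _ = refl
bitXor-assoc {1} {1} {0} _ _ _ = refl
bitXor-assoc {1} {1} {1} _ _ _ = refl
bitXor-assoc {2+ _} (s≤s (s≤s ())) _ _
bitXor-assoc {j = 2+ _} _ (s≤s (s≤s ())) _
bitXor-assoc {k = 2+ _} _ _ (s≤s (s≤s ()))

m≡m%2+2*[m/2] : ∀ m → m ≡ m % 2 + 2 * (m / 2)
m≡m%2+2*[m/2] m = trans (m≡m%n+[m/n]*n m 2) (cong (m % 2 +_) (*-comm (m / 2) 2))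

≡-by-%2-/2 : ∀ {m n} → m % 2 ≡ n % 2 → m / 2 ≡ n / 2 → m ≡ n
≡-by-%2-/2 {m} {n} %≡ /≡ = begin
  m                  ≡⟨ m≡m%2+2*[m/2] m ⟩
  m % 2 + 2 * (m / 2) ≡⟨ cong₂ (λ i q → i + 2 * q) %≡ /≡ ⟩
  n % 2 + 2 * (n / 2) ≡⟨ m≡m%2+2*[m/2] n ⟨
  n                  ∎
  where open ≡-Reasoning

[i+2*q]%2≡i : ∀ {i} q → i < 2 → (i + 2 * q) % 2 ≡ i
[i+2*q]%2≡i {i} q i<2 = begin
  (i + 2 * q) % 2 ≡⟨ cong (λ t → (i + t) % 2) (*-comm 2 q) ⟩
  (i + q * 2) % 2 ≡⟨ [m+kn]%n≡m%n i q 2 ⟩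
  i % 2           ≡⟨ m<n⇒m%n≡m i<2 ⟩
  i               ∎
  where open ≡-Reasoning

[i+2*q]/2≡q : ∀ {i} q → i < 2 → (i + 2 * q) / 2 ≡ q
[i+2*q]/2≡q {i} q i<2 = begin
  (i + 2 * q) / 2   ≡⟨ cong (λ t → (i + t) / 2) (*-comm 2 q) ⟩
  (i + q * 2) / 2   ≡⟨ +-distrib-/ i (q * 2) no-carry ⟩
  i / 2 + q * 2 / 2 ≡⟨ cong₂ _+_ (m<n⇒m/n≡0 i<2) (m*n/n≡m q 2) ⟩
  q                 ∎
  where
  open ≡-Reasoning
  no-carry : i % 2 + q * 2 % 2 < 2
  no-carry = subst (_< 2) (sym (trans (cong₂ _+_ (m<n⇒m%n≡m i<2) (m*n%n≡0 q 2)) (+-identityʳ i))) i<2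

/2-≤ : ∀ {m f} → m ≤ suc f → m / 2 ≤ f
/2-≤ {m} {f} m≤1+f = ≤-pred (≤-<-trans (/-monoˡ-≤ 2 m≤1+f) (m/n<m (suc f) 2 (s≤s (s≤s z≤n))))

xorFuel-irrelevant : ∀ f g {m n} → m ≤ f → n ≤ f → m ≤ g → n ≤ g →
                     xorFuel f m n ≡ xorFuel g m n
xorFuel-irrelevant zero    zero    _   _   _   _   = refl
xorFuel-irrelevant zero    (suc g) z≤n z≤n _   _   = cong (2 *_) (xorFuel-irrelevant zero g z≤n z≤n z≤n z≤n)
xorFuel-irrelevant (suc f) zero    _   _   z≤n z≤n = cong (2 *_) (xorFuel-irrelevant f zero z≤n z≤n z≤n z≤n)
xorFuel-irrelevant (suc f) (suc g) {m} {n} m≤f n≤f m≤g n≤g =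
  cong (λ q → bitXor (m % 2) (n % 2) + 2 * q) (xorFuel-irrelevant f g (/2-≤ m≤f) (/2-≤ n≤f) (/2-≤ m≤g) (/2-≤ n≤g))

⊕-step : ∀ m n → m ⊕ n ≡ bitXor (m % 2) (n % 2) + 2 * (m / 2 ⊕ n / 2)
⊕-step m n with m + n in m+n≡
... | zero rewrite m+n≡0⇒m≡0 m m+n≡ | m+n≡0⇒n≡0 m m+n≡ = refl
... | suc f = cong (λ q → bitXor (m % 2) (n % 2) + 2 * q)
  (xorFuel-irrelevant f (m / 2 + n / 2) (/2-≤ m≤1+f) (/2-≤ n≤1+f) (m≤m+n _ _) (m≤n+m _ _))
  where
  m≤1+f : m ≤ suc f
  m≤1+f = subst (m ≤_) m+n≡ (m≤m+n m n)
  n≤1+f : n ≤ suc f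
  n≤1+f = subst (n ≤_) m+n≡ (m≤n+m n m)

⊕-%2 : ∀ m n → (m ⊕ n) % 2 ≡ bitXor (m % 2) (n % 2)
⊕-%2 m n = trans (cong (_% 2) (⊕-step m n)) ([i+2*q]%2≡i (m / 2 ⊕ n / 2) (bitXor<2 (m % 2) (n % 2)))

⊕-/2 : ∀ m n → (m ⊕ n) / 2 ≡ m / 2 ⊕ n / 2
⊕-/2 m n = trans (cong (_/ 2) (⊕-step m n)) ([i+2*q]/2≡q (m / 2 ⊕ n / 2) (bitXor<2 (m % 2) (n % 2)))

bit-induction : (P : ℕ → ℕ → ℕ → Set) → P 0 0 0 →
                (∀ x y z → P (x / 2) (y / 2) (z / 2) → P x y z) →
                ∀ x y z → P x y z
bit-induction P base step x y z =
  go (x + y + z) x y z (≤-trans (m≤m+n x y) (m≤m+n _ z)) (≤-trans (m≤n+m y x) (m≤m+n _ z)) (m≤n+m z _)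
  where
  go : ∀ f x y z → x ≤ f → y ≤ f → z ≤ f → P x y z
  go zero    _ _ _ z≤n z≤n z≤n = base
  go (suc f) x y z x≤ y≤ z≤ = step x y z (go f (x / 2) (y / 2) (z / 2) (/2-≤ x≤) (/2-≤ y≤) (/2-≤ z≤))

⊕-comm : ∀ m n → m ⊕ n ≡ n ⊕ m
⊕-comm m n = bit-induction (λ m n _ → m ⊕ n ≡ n ⊕ m) refl
  (λ m n _ ih → ≡-by-%2-/2
    (trans (⊕-%2 m n) (trans (bitXor-comm (m % 2) (n % 2)) (sym (⊕-%2 n m))))
    (trans (⊕-/2 m n) (trans ih (sym (⊕-/2 n m)))))
  m n 0

⊕-identityʳ : ∀ m → m ⊕ 0 ≡ m
⊕-identityʳ m = bit-induction (λ m _ _ → m ⊕ 0 ≡ m) refl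
  (λ m _ _ ih → ≡-by-%2-/2
    (trans (⊕-%2 m 0) (bitXor-identityʳ (m%n<n m 2)))
    (trans (⊕-/2 m 0) ih))
  m 0 0

⊕-identityˡ : ∀ m → 0 ⊕ m ≡ m
⊕-identityˡ m = trans (⊕-comm 0 m) (⊕-identityʳ m)

⊕-same : ∀ m → m ⊕ m ≡ 0
⊕-same m = bit-induction (λ m _ _ → m ⊕ m ≡ 0) refl
  (λ m _ _ ih → ≡-by-%2-/2
    (trans (⊕-%2 m m) (bitXor-≡ {m % 2} refl))
    (trans (⊕-/2 m m) ih))
  m 0 0

⊕-assoc : ∀ x y z → (x ⊕ y) ⊕ z ≡ x ⊕ (y ⊕ z)
⊕-assoc = bit-induction (λ x y z → (x ⊕ y) ⊕ z ≡ x ⊕ (y ⊕ z)) refl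
  λ x y z ih → ≡-by-%2-/2
    (begin
      ((x ⊕ y) ⊕ z) % 2                      ≡⟨ ⊕-%2 (x ⊕ y) z ⟩
      bitXor ((x ⊕ y) % 2) (z % 2)            ≡⟨ cong (λ i → bitXor i (z % 2)) (⊕-%2 x y) ⟩
      bitXor (bitXor (x % 2) (y % 2)) (z % 2) ≡⟨ bitXor-assoc (m%n<n x 2) (m%n<n y 2) (m%n<n z 2) ⟩
      bitXor (x % 2) (bitXor (y % 2) (z % 2)) ≡⟨ cong (bitXor (x % 2)) (⊕-%2 y z) ⟨
      bitXor (x % 2) ((y ⊕ z) % 2)            ≡⟨ ⊕-%2 x (y ⊕ z) ⟨
      (x ⊕ (y ⊕ z)) % 2                      ∎)
    (begin
      ((x ⊕ y) ⊕ z) / 2           ≡⟨ trans (⊕-/2 (x ⊕ y) z) (cong (_⊕ z / 2) (⊕-/2 x y)) ⟩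
      (x / 2 ⊕ y / 2) ⊕ z / 2     ≡⟨ ih ⟩
      x / 2 ⊕ (y / 2 ⊕ z / 2)     ≡⟨ trans (⊕-/2 x (y ⊕ z)) (cong (x / 2 ⊕_) (⊕-/2 y z)) ⟨
      (x ⊕ (y ⊕ z)) / 2           ∎)
  where open ≡-Reasoning

⊕-isCommutativeMonoid : IsCommutativeMonoid _≡_ _⊕_ 0
⊕-isCommutativeMonoid = record
  { isMonoid = record
    { isSemigroup = record { isMagma = isMagma _⊕_ ; assoc = ⊕-assoc }
    ; identity    = ⊕-identityˡ , ⊕-identityʳ
    }
  ; comm = ⊕-comm
  }

⊕-commutativeMonoid : CommutativeMonoid 0ℓ 0ℓ
⊕-commutativeMonoid = record { isCommutativeMonoid = ⊕-isCommutativeMonoid }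

open CommutativeSemigroupProperties (CommutativeMonoid.commutativeSemigroup ⊕-commutativeMonoid)
  using () renaming (interchange to ⊕-interchange)

⊕-cancelʳ : ∀ x y → (x ⊕ y) ⊕ y ≡ x
⊕-cancelʳ x y = trans (⊕-assoc x y y) (trans (cong (x ⊕_) (⊕-same y)) (⊕-identityʳ x))

⊕≡⇒≡⊕ : ∀ {x y z} → x ⊕ y ≡ z → x ≡ z ⊕ y
⊕≡⇒≡⊕ {x} {y} x⊕y≡z = trans (sym (⊕-cancelʳ x y)) (cong (_⊕ y) x⊕y≡z)

≡⊕⇒⊕≡ : ∀ {x y z} → x ≡ z ⊕ y → x ⊕ y ≡ z
≡⊕⇒⊕≡ {x} {y} {z} x≡z⊕y = trans (cong (_⊕ y) x≡z⊕y) (⊕-cancelʳ z y)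

-- Xor below a power of two

/2-< : ∀ {x N} → x < 2 * N → x / 2 < N
/2-< {x} {N} x<2N = m<n*o⇒m/o<n (subst (x <_) (*-comm 2 N) x<2N)

i+2*t<2*N : ∀ {i t N} → i < 2 → t < N → i + 2 * t < 2 * N
i+2*t<2*N {i} {t} {N} i<2 t<N = ≤-trans (+-monoˡ-≤ (2 * t) i<2)
  (subst (_≤ 2 * N) (*-suc 2 t) (*-monoʳ-≤ 2 t<N))

⊕-<2^ : ∀ b {x y} → x < 2 ^ b → y < 2 ^ b → x ⊕ y < 2 ^ b
⊕-<2^ zero    (s≤s z≤n) (s≤s z≤n) = s≤s z≤n
⊕-<2^ (suc b) {x} {y} x< y< = subst (_< 2 ^ suc b) (sym (⊕-step x y))
  (i+2*t<2*N (bitXor<2 (x % 2) (y % 2)) (⊕-<2^ b (/2-< x<) (/2-< y<)))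

2*k+x≡x%2+2*[k+x/2] : ∀ k x → 2 * k + x ≡ x % 2 + 2 * (k + x / 2)
2*k+x≡x%2+2*[k+x/2] k x = trans (cong (2 * k +_) (m≡m%2+2*[m/2] x)) (rearrange k (x % 2) (x / 2))
  where
  rearrange : ∀ k r q → 2 * k + (r + 2 * q) ≡ r + 2 * (k + q)
  rearrange = solve-∀

2^b⊕x≡2^b+x : ∀ b {x} → x < 2 ^ b → 2 ^ b ⊕ x ≡ 2 ^ b + x
2^b⊕x≡2^b+x zero    (s≤s z≤n) = refl
2^b⊕x≡2^b+x (suc b) {x} x< = ≡-by-%2-/2
  (begin
    (2 * N ⊕ x) % 2                 ≡⟨ ⊕-%2 (2 * N) x ⟩
    bitXor ((2 * N) % 2) (x % 2)     ≡⟨ cong (λ i → bitXor i (x % 2)) ([i+2*q]%2≡i N (s≤s z≤n)) ⟩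
    bitXor 0 (x % 2)                 ≡⟨ trans (bitXor-comm 0 (x % 2)) (bitXor-identityʳ (m%n<n x 2)) ⟩
    x % 2                            ≡⟨ [i+2*q]%2≡i (N + x / 2) (m%n<n x 2) ⟨
    (x % 2 + 2 * (N + x / 2)) % 2    ≡⟨ cong (_% 2) (2*k+x≡x%2+2*[k+x/2] N x) ⟨
    (2 * N + x) % 2                  ∎)
  (begin
    (2 * N ⊕ x) / 2                 ≡⟨ ⊕-/2 (2 * N) x ⟩
    (2 * N) / 2 ⊕ x / 2              ≡⟨ cong (_⊕ x / 2) ([i+2*q]/2≡q N (s≤s z≤n)) ⟩
    N ⊕ x / 2                        ≡⟨ 2^b⊕x≡2^b+x b (/2-< x<) ⟩
    N + x / 2                        ≡⟨ [i+2*q]/2≡q (N + x / 2) (m%n<n x 2) ⟨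
    (x % 2 + 2 * (N + x / 2)) / 2    ≡⟨ cong (_/ 2) (2*k+x≡x%2+2*[k+x/2] N x) ⟨
    (2 * N + x) / 2                  ∎)
  where
  N = 2 ^ b
  open ≡-Reasoning

-- Finite sums

∑< : ℕ → (ℕ → ℕ) → ℕ
∑< zero    f = 0
∑< (suc m) f = f 0 + ∑< m (f ∘ suc)

syntax ∑< m (λ i → e) = ∑[ i < m ] e

∑<-cong : ∀ m {f g : ℕ → ℕ} → (∀ {i} → i < m → f i ≡ g i) → ∑< m f ≡ ∑< m g
∑<-cong zero    _   = refl
∑<-cong (suc m) f≡g = cong₂ _+_ (f≡g z<s) (∑<-cong m (f≡g ∘ s<s))

∑<-const : ∀ m k → ∑[ _ < m ] k ≡ m * k
∑<-const zero    k = refl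
∑<-const (suc m) k = cong (k +_) (∑<-const m k)

∑<-+ : ∀ m (f g : ℕ → ℕ) → ∑[ i < m ] (f i + g i) ≡ ∑< m f + ∑< m g
∑<-+ zero    f g = refl
∑<-+ (suc m) f g = trans (cong (f 0 + g 0 +_) (∑<-+ m (f ∘ suc) (g ∘ suc)))
  (+-+-interchange (f 0) (g 0) (∑< m (f ∘ suc)) (∑< m (g ∘ suc)))
  where
  +-+-interchange : ∀ a b c d → (a + b) + (c + d) ≡ (a + c) + (b + d)
  +-+-interchange = solve-∀

∑<-split : ∀ m n f → ∑< (m + n) f ≡ ∑< m f + ∑[ i < n ] f (m + i)
∑<-split zero    n f = refl
∑<-split (suc m) n f = trans (cong (f 0 +_) (∑<-split m n (f ∘ suc))) (sym (+-assoc (f 0) _ _))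

∑<-swap : ∀ m n (f : ℕ → ℕ → ℕ) → ∑[ i < m ] ∑[ j < n ] f i j ≡ ∑[ j < n ] ∑[ i < m ] f i j
∑<-swap zero    n f = sym (trans (∑<-const n 0) (*-zeroʳ n))
∑<-swap (suc m) n f = trans (cong (∑< n (f 0) +_) (∑<-swap m n (f ∘ suc)))
  (sym (∑<-+ n (f 0) (λ j → ∑[ i < m ] f (suc i) j)))

∑<-zero : ∀ m → ∑[ _ < m ] 0 ≡ 0
∑<-zero m = trans (∑<-const m 0) (*-zeroʳ m)

δ : ℕ → ℕ → ℕ
δ x y = if does (x ≟ y) then 1 else 0

δ-cong : ∀ {x y x′ y′} → (x ≡ y → x′ ≡ y′) → (x′ ≡ y′ → x ≡ y) → δ x y ≡ δ x′ y′
δ-cong {x} {y} {x′} {y′} ⇒ ⇐ with x ≟ y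
... | yes x≡y rewrite dec-true (x ≟ y) x≡y | dec-true (x′ ≟ y′) (⇒ x≡y) = refl
... | no  x≢y rewrite dec-false (x ≟ y) x≢y | dec-false (x′ ≟ y′) (x≢y ∘ ⇐) = refl

∑<-δ : ∀ {m t} → t < m → ∑[ i < m ] δ i t ≡ 1
∑<-δ {suc m} {zero}  _         = cong suc (∑<-zero m)
∑<-δ {suc m} {suc t} (s≤s t<m) = ∑<-δ t<m

∑box : ∀ {k} → Vec ℕ k → (Vec ℕ k → ℕ) → ℕ
∑box []       F = F []
∑box (l ∷ ls) F = ∑[ p < l ] ∑box ls (F ∘ (p ∷_))

∑box-cong : ∀ {k} (ls : Vec ℕ k) {F G : Vec ℕ k → ℕ} →
            (∀ {rs} → Pointwise _<_ rs ls → F rs ≡ G rs) → ∑box ls F ≡ ∑box ls G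
∑box-cong []       F≡G = F≡G []
∑box-cong (l ∷ ls) F≡G = ∑<-cong l (λ p<l → ∑box-cong ls (λ rs<ls → F≡G (p<l ∷ rs<ls)))

∑box-const : ∀ {k} (ls : Vec ℕ k) m → ∑box ls (λ _ → m) ≡ foldr′ _*_ m ls
∑box-const []       m = refl
∑box-const (l ∷ ls) m = trans (∑<-cong l (λ _ → ∑box-const ls m)) (∑<-const l _)

∑box-zero : ∀ {k} (ls : Vec ℕ k) → ∑box ls (λ _ → 0) ≡ 0
∑box-zero []       = refl
∑box-zero (l ∷ ls) = trans (∑<-cong l (λ _ → ∑box-zero ls)) (∑<-zero l)

∑<-∑box-swap : ∀ m {k} (ls : Vec ℕ k) (F : ℕ → Vec ℕ k → ℕ) →
               ∑[ i < m ] ∑box ls (F i) ≡ ∑box ls (λ rs → ∑[ i < m ] F i rs)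
∑<-∑box-swap m []       F = refl
∑<-∑box-swap m (l ∷ ls) F = trans (∑<-swap m l (λ i p → ∑box ls (F i ∘ (p ∷_))))
  (∑<-cong l (λ {p} _ → ∑<-∑box-swap m ls (λ i → F i ∘ (p ∷_))))

∑𝔹 : ∀ k → (Vec Bool k → ℕ) → ℕ
∑𝔹 zero    G = G []
∑𝔹 (suc k) G = ∑𝔹 k (G ∘ (false ∷_)) + ∑𝔹 k (G ∘ (true ∷_))

∑𝔹-cong : ∀ k {G H : Vec Bool k → ℕ} → (∀ hs → G hs ≡ H hs) → ∑𝔹 k G ≡ ∑𝔹 k H
∑𝔹-cong zero    G≡H = G≡H []
∑𝔹-cong (suc k) G≡H = cong₂ _+_ (∑𝔹-cong k (G≡H ∘ (false ∷_))) (∑𝔹-cong k (G≡H ∘ (true ∷_)))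

∑<-∑𝔹-swap : ∀ m k (G : ℕ → Vec Bool k → ℕ) →
             ∑[ i < m ] ∑𝔹 k (G i) ≡ ∑𝔹 k (λ hs → ∑[ i < m ] G i hs)
∑<-∑𝔹-swap m zero    G = refl
∑<-∑𝔹-swap m (suc k) G = trans (∑<-+ m _ _)
  (cong₂ _+_ (∑<-∑𝔹-swap m k (λ i → G i ∘ (false ∷_))) (∑<-∑𝔹-swap m k (λ i → G i ∘ (true ∷_))))

-- A number below N + c is written high N h + r with r < width N c h, the flag h recording
-- whether it is at least N.
high : ℕ → Bool → ℕ
high N h = if h then N else 0

width : ℕ → ℕ → Bool → ℕ
width N c h = if h then c else N

∑box-split : ∀ N c k (F : Vec ℕ k → ℕ) →
  ∑box (replicate k (N + c)) F ≡
  ∑𝔹 k (λ hs → ∑box (map (width N c) hs) (λ rs → F (zipWith _+_ (map (high N) hs) rs)))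
∑box-split N c zero    F = refl
∑box-split N c (suc k) F = begin
  ∑[ p < N + c ] ∑box (replicate k (N + c)) (F ∘ (p ∷_))
    ≡⟨ ∑<-cong (N + c) (λ {p} _ → ∑box-split N c k (F ∘ (p ∷_))) ⟩
  ∑[ p < N + c ] ∑𝔹 k (G p)
    ≡⟨ ∑<-split N c (λ p → ∑𝔹 k (G p)) ⟩
  ∑[ p < N ] ∑𝔹 k (G p) + ∑[ i < c ] ∑𝔹 k (G (N + i))
    ≡⟨ cong₂ _+_ (∑<-∑𝔹-swap N k G) (∑<-∑𝔹-swap c k (G ∘ (N +_))) ⟩
  ∑𝔹 (suc k) (λ hs → ∑box (map (width N c) hs) (λ rs → F (zipWith _+_ (map (high N) hs) rs)))
    ∎
  where
  open ≡-Reasoning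
  G : ℕ → Vec Bool k → ℕ
  G p hs = ∑box (map (width N c) hs) (λ rs → F (p ∷ zipWith _+_ (map (high N) hs) rs))

-- Counting P-positions

module _ {B : Set} {P : Pred B 0ℓ} (P? : Decidable P) where

  length-filter-map : ∀ {A : Set} (f : A → B) xs →
                      length (filter P? (List.map f xs)) ≡ length (filter (P? ∘ f) xs)
  length-filter-map f []       = refl
  length-filter-map f (x ∷ xs) with does (P? (f x))
  ... | true  = cong suc (length-filter-map f xs)
  ... | false = length-filter-map f xs

  length-filter-concatMap : ∀ (g : ℕ → List B) h n →
    length (filter P? (concatMap g (applyUpTo h n))) ≡ ∑[ i < n ] length (filter P? (g (h i)))
  length-filter-concatMap g h zero    = refl
  length-filter-concatMap g h (suc n) = begin
    length (filter P? (g (h 0) ++ rest))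
      ≡⟨ cong length (filter-++ P? (g (h 0)) rest) ⟩
    length (filter P? (g (h 0)) ++ filter P? rest)
      ≡⟨ length-++ (filter P? (g (h 0))) ⟩
    length (filter P? (g (h 0))) + length (filter P? rest)
      ≡⟨ cong (length (filter P? (g (h 0))) +_) (length-filter-concatMap g (h ∘ suc) n) ⟩
    ∑[ i < suc n ] length (filter P? (g (h i)))
      ∎
    where
    open ≡-Reasoning
    rest = concatMap g (applyUpTo (h ∘ suc) n)

length-filter-tuples : ∀ k m {P : Pred (Vec ℕ k) 0ℓ} (P? : Decidable P) →
  length (filter P? (tuples k m)) ≡ ∑box (replicate k (suc m)) (λ v → if does (P? v) then 1 else 0)
length-filter-tuples zero    m P? with does (P? [])
... | true  = refl
... | false = refl
length-filter-tuples (suc k) m P? = begin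
  length (filter P? (concatMap (λ p → List.map (p ∷_) (tuples k m)) (upTo (suc m))))
    ≡⟨ length-filter-concatMap P? (λ p → List.map (p ∷_) (tuples k m)) id (suc m) ⟩
  ∑[ p < suc m ] length (filter P? (List.map (p ∷_) (tuples k m)))
    ≡⟨ ∑<-cong (suc m) (λ {p} _ → length-filter-map P? (p ∷_) (tuples k m)) ⟩
  ∑[ p < suc m ] length (filter (P? ∘ (p ∷_)) (tuples k m))
    ≡⟨ ∑<-cong (suc m) (λ {p} _ → length-filter-tuples k m (P? ∘ (p ∷_))) ⟩
  ∑box (replicate (suc k) (suc m)) (λ v → if does (P? v) then 1 else 0)
    ∎
  where open ≡-Reasoning

nimSum-<2^ : ∀ b {k} {rs : Vec ℕ k} → All (_< 2 ^ b) rs → nimSum rs < 2 ^ b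
nimSum-<2^ b []         = m^n>0 2 b
nimSum-<2^ b (r< ∷ rs<) = ⊕-<2^ b r< (nimSum-<2^ b rs<)

pointwise-<-≤-trans : ∀ {N k} {rs ls : Vec ℕ k} → Pointwise _<_ rs ls → All (_≤ N) ls → All (_< N) rs
pointwise-<-≤-trans []             []           = []
pointwise-<-≤-trans (r<l ∷ rs<ls) (l≤N ∷ ls≤N) = <-≤-trans r<l l≤N ∷ pointwise-<-≤-trans rs<ls ls≤N

δ-⊕ : ∀ x s t → δ (x ⊕ s) t ≡ δ x (t ⊕ s)
δ-⊕ x s t = δ-cong {x ⊕ s} {t} (⊕≡⇒≡⊕ {x} {s}) (≡⊕⇒⊕≡ {x} {s})

δ-⊕-swap : ∀ p s t → δ (p ⊕ s) t ≡ δ s (p ⊕ t)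
δ-⊕-swap p s t = trans (cong (λ u → δ u t) (⊕-comm p s))
  (trans (δ-⊕ s p t) (cong (δ s) (⊕-comm t p)))

-- The pile at index i ranges over all of [0, 2^b) and is the unique solution of the
-- nim-sum equation given the other piles.
∑box-δ-nimSum : ∀ b {k} (ls : Vec ℕ (suc k)) (i : Fin (suc k)) {t} → t < 2 ^ b →
                lookup ls i ≡ 2 ^ b → All (_≤ 2 ^ b) ls →
                ∑box ls (λ rs → δ (nimSum rs) t) ≡ foldr′ _*_ 1 (removeAt ls i)
∑box-δ-nimSum b (l ∷ ls) Fin.zero {t} t< refl (_ ∷ ls≤) = begin
  ∑[ x < 2 ^ b ] ∑box ls (λ rs → δ (x ⊕ nimSum rs) t)  ≡⟨ ∑<-∑box-swap (2 ^ b) ls _ ⟩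
  ∑box ls (λ rs → ∑[ x < 2 ^ b ] δ (x ⊕ nimSum rs) t)  ≡⟨ ∑box-cong ls unique-solution ⟩
  ∑box ls (λ _ → 1)                                    ≡⟨ ∑box-const ls 1 ⟩
  foldr′ _*_ 1 ls                                      ∎
  where
  open ≡-Reasoning
  unique-solution : ∀ {rs} → Pointwise _<_ rs ls → ∑[ x < 2 ^ b ] δ (x ⊕ nimSum rs) t ≡ 1
  unique-solution {rs} rs<ls = trans (∑<-cong (2 ^ b) (λ {x} _ → δ-⊕ x (nimSum rs) t))
    (∑<-δ (⊕-<2^ b t< (nimSum-<2^ b (pointwise-<-≤-trans rs<ls ls≤))))
∑box-δ-nimSum b (l ∷ ls@(_ ∷ _)) (Fin.suc j) {t} t< ls[j]≡ (l≤ ∷ ls≤) = begin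
  ∑[ p < l ] ∑box ls (λ rs → δ (p ⊕ nimSum rs) t)  ≡⟨ ∑<-cong l fixed-first ⟩
  ∑[ p < l ] foldr′ _*_ 1 (removeAt ls j)          ≡⟨ ∑<-const l _ ⟩
  l * foldr′ _*_ 1 (removeAt ls j)                 ∎
  where
  open ≡-Reasoning
  fixed-first : ∀ {p} → p < l → ∑box ls (λ rs → δ (p ⊕ nimSum rs) t) ≡ foldr′ _*_ 1 (removeAt ls j)
  fixed-first {p} p<l = trans (∑box-cong ls (λ {rs} _ → δ-⊕-swap p (nimSum rs) t))
    (∑box-δ-nimSum b ls j (⊕-<2^ b (<-≤-trans p<l l≤) t<) ls[j]≡ ls≤)

parity : ∀ {k} → Vec Bool k → Bool
parity = foldr′ _xor_ false

high-⊕ : ∀ N h h′ → high N h ⊕ high N h′ ≡ high N (h xor h′)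
high-⊕ N false false = refl
high-⊕ N false true  = ⊕-identityˡ N
high-⊕ N true  false = ⊕-identityʳ N
high-⊕ N true  true  = ⊕-same N

high+≡high⊕ : ∀ b h {r} → r < 2 ^ b → high (2 ^ b) h + r ≡ high (2 ^ b) h ⊕ r
high+≡high⊕ b false {r} _   = sym (⊕-identityˡ r)
high+≡high⊕ b true      r<N = sym (2^b⊕x≡2^b+x b r<N)

nimSum-high+ : ∀ b {k} (hs : Vec Bool k) {rs} → All (_< 2 ^ b) rs →
  nimSum (zipWith _+_ (map (high (2 ^ b)) hs) rs) ≡ high (2 ^ b) (parity hs) ⊕ nimSum rs
nimSum-high+ b []                      []         = refl
nimSum-high+ b (h ∷ hs) {r ∷ rs} (r<N ∷ rs<N) = begin
  (H h + r) ⊕ nimSum (zipWith _+_ (map H hs) rs)   ≡⟨ cong₂ _⊕_ (high+≡high⊕ b h r<N) (nimSum-high+ b hs rs<N) ⟩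
  (H h ⊕ r) ⊕ (H (parity hs) ⊕ nimSum rs)          ≡⟨ ⊕-interchange (H h) r (H (parity hs)) (nimSum rs) ⟩
  (H h ⊕ H (parity hs)) ⊕ (r ⊕ nimSum rs)          ≡⟨ cong (_⊕ (r ⊕ nimSum rs)) (high-⊕ (2 ^ b) h (parity hs)) ⟩
  H (h xor parity hs) ⊕ (r ⊕ nimSum rs)            ∎
  where
  open ≡-Reasoning
  H = high (2 ^ b)

δ-high⊕-0 : ∀ b h {s} → s < 2 ^ b → δ (high (2 ^ b) h ⊕ s) 0 ≡ (if h then 0 else δ s 0)
δ-high⊕-0 b false {s} _   = cong (λ u → δ u 0) (⊕-identityˡ s)
δ-high⊕-0 b true  {s} s<N rewrite 2^b⊕x≡2^b+x b s<N
  | dec-false (2 ^ b + s ≟ 0) (m<n⇒n≢0 (<-≤-trans (m^n>0 2 b) (m≤m+n (2 ^ b) s))) = refl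

width-≤ : ∀ {N c} → c ≤ N → ∀ {k} (hs : Vec Bool k) → All (_≤ N) (map (width N c) hs)
width-≤ c≤N []           = []
width-≤ c≤N (false ∷ hs) = ≤-refl ∷ width-≤ c≤N hs
width-≤ c≤N (true  ∷ hs) = c≤N ∷ width-≤ c≤N hs

∑box-δ-nimSum-high+ : ∀ b {c} → c ≤ 2 ^ b → ∀ {k} (hs : Vec Bool k) →
  ∑box (map (width (2 ^ b) c) hs) (λ rs → δ (nimSum (zipWith _+_ (map (high (2 ^ b)) hs) rs)) 0) ≡
  ∑box (map (width (2 ^ b) c) hs) (λ rs → if parity hs then 0 else δ (nimSum rs) 0)
∑box-δ-nimSum-high+ b c≤N hs = ∑box-cong (map (width (2 ^ b) _) hs) λ rs<ls →
  let rs<N = pointwise-<-≤-trans rs<ls (width-≤ c≤N hs) in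
  trans (cong (λ u → δ u 0) (nimSum-high+ b hs rs<N)) (δ-high⊕-0 b (parity hs) (nimSum-<2^ b rs<N))

-- Each product lists its factors in the order removeAt leaves them, so that it is
-- definitionally the value returned by ∑box-δ-nimSum.
classCount : ℕ → ℕ → ℕ → Vec Bool 4 → ℕ
classCount N c A (false ∷ false ∷ false ∷ false ∷ []) = N * (N * (N * 1))
classCount N c A (false ∷ false ∷ true  ∷ true  ∷ []) = N * (c * (c * 1))
classCount N c A (false ∷ true  ∷ false ∷ true  ∷ []) = c * (N * (c * 1))
classCount N c A (false ∷ true  ∷ true  ∷ false ∷ []) = c * (c * (N * 1))
classCount N c A (true  ∷ false ∷ false ∷ true  ∷ []) = c * (N * (c * 1))
classCount N c A (true  ∷ false ∷ true  ∷ false ∷ []) = c * (c * (N * 1))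
classCount N c A (true  ∷ true  ∷ false ∷ false ∷ []) = c * (c * (N * 1))
classCount N c A (true  ∷ true  ∷ true  ∷ true  ∷ []) = A
classCount N c A _                                   = 0

∑𝔹-classCount : ∀ N c A → ∑𝔹 4 (classCount N c A) ≡ N * (N * (N * 1)) + 6 * (c * c) * N + A
∑𝔹-classCount = collect
  where
  -- ∑𝔹 4 unfolded by hand: the solver does not evaluate ∑𝔹.
  collect : ∀ N c A →
    (((N * (N * (N * 1)) + 0) + (0 + N * (c * (c * 1)))) +
     ((0 + c * (N * (c * 1))) + (c * (c * (N * 1)) + 0))) +
    (((0 + c * (N * (c * 1))) + (c * (c * (N * 1)) + 0)) +
     ((c * (c * (N * 1)) + 0) + (0 + A)))
    ≡ N * (N * (N * 1)) + 6 * (c * c) * N + A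
  collect = solve-∀

module _ (b r : ℕ) (r<N : r < 2 ^ b) where

  private
    W : Bool → ℕ
    W = width (2 ^ b) (suc r)

    lowPile : ∀ (hs : Vec Bool 4) (i : Fin 4) → lookup (map W hs) i ≡ 2 ^ b →
              ∑box (map W hs) (λ rs → δ (nimSum rs) 0) ≡ foldr′ _*_ 1 (removeAt (map W hs) i)
    lowPile hs i W[i]≡N = ∑box-δ-nimSum b (map W hs) i (m^n>0 2 b) W[i]≡N (width-≤ r<N hs)

  ∑box-classCount : ∀ hs →
    ∑box (map W hs) (λ rs → if parity hs then 0 else δ (nimSum rs) 0) ≡ classCount (2 ^ b) (suc r) (a 4 r) hs
  ∑box-classCount hs@(false ∷ false ∷ false ∷ false ∷ []) = lowPile hs Fin.zero refl
  ∑box-classCount hs@(false ∷ false ∷ true  ∷ true  ∷ []) = lowPile hs Fin.zero refl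
  ∑box-classCount hs@(false ∷ true  ∷ false ∷ true  ∷ []) = lowPile hs Fin.zero refl
  ∑box-classCount hs@(false ∷ true  ∷ true  ∷ false ∷ []) = lowPile hs Fin.zero refl
  ∑box-classCount hs@(true  ∷ false ∷ false ∷ true  ∷ []) = lowPile hs (Fin.suc Fin.zero) refl
  ∑box-classCount hs@(true  ∷ false ∷ true  ∷ false ∷ []) = lowPile hs (Fin.suc Fin.zero) refl
  ∑box-classCount hs@(true  ∷ true  ∷ false ∷ false ∷ []) = lowPile hs (Fin.suc (Fin.suc Fin.zero)) refl
  ∑box-classCount    (true  ∷ true  ∷ true  ∷ true  ∷ []) = sym (length-filter-tuples 4 r (λ v → nimSum v ≟ 0))
  ∑box-classCount hs@(false ∷ false ∷ false ∷ true  ∷ []) = ∑box-zero (map W hs)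
  ∑box-classCount hs@(false ∷ false ∷ true  ∷ false ∷ []) = ∑box-zero (map W hs)
  ∑box-classCount hs@(false ∷ true  ∷ false ∷ false ∷ []) = ∑box-zero (map W hs)
  ∑box-classCount hs@(true  ∷ false ∷ false ∷ false ∷ []) = ∑box-zero (map W hs)
  ∑box-classCount hs@(false ∷ true  ∷ true  ∷ true  ∷ []) = ∑box-zero (map W hs)
  ∑box-classCount hs@(true  ∷ false ∷ true  ∷ true  ∷ []) = ∑box-zero (map W hs)
  ∑box-classCount hs@(true  ∷ true  ∷ false ∷ true  ∷ []) = ∑box-zero (map W hs)
  ∑box-classCount hs@(true  ∷ true  ∷ true  ∷ false ∷ []) = ∑box-zero (map W hs)

a₄[2^b+r] : ∀ b r → r < 2 ^ b → a 4 (2 ^ b + r) ≡ 2 ^ (3 * b) + 6 * (suc r * suc r) * 2 ^ b + a 4 r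
a₄[2^b+r] b r r<N = begin
  a 4 (N + r)
    ≡⟨ length-filter-tuples 4 (N + r) (λ v → nimSum v ≟ 0) ⟩
  ∑box (replicate 4 (suc (N + r))) P
    ≡⟨ cong (λ m → ∑box (replicate 4 m) P) (+-suc N r) ⟨
  ∑box (replicate 4 (N + suc r)) P
    ≡⟨ ∑box-split N (suc r) 4 P ⟩
  ∑𝔹 4 (λ hs → ∑box (map W hs) (λ rs → P (zipWith _+_ (map (high N) hs) rs)))
    ≡⟨ ∑𝔹-cong 4 (∑box-δ-nimSum-high+ b r<N) ⟩
  ∑𝔹 4 (λ hs → ∑box (map W hs) (λ rs → if parity hs then 0 else P rs))
    ≡⟨ ∑𝔹-cong 4 (∑box-classCount b r r<N) ⟩
  ∑𝔹 4 (classCount N (suc r) (a 4 r))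
    ≡⟨ ∑𝔹-classCount N (suc r) (a 4 r) ⟩
  N ^ 3 + 6 * (suc r * suc r) * N + a 4 r
    ≡⟨ cong (λ t → t + 6 * (suc r * suc r) * N + a 4 r) (trans (^-*-assoc 2 b 3) (cong (2 ^_) (*-comm b 3))) ⟩
  2 ^ (3 * b) + 6 * (suc r * suc r) * N + a 4 r
    ∎
  where
  open ≡-Reasoning
  N = 2 ^ b
  W = width N (suc r)
  P : Vec ℕ 4 → ℕ
  P v = δ (nimSum v) 0

-- Binary logarithm

2*⌊n/2⌋≤n : ∀ n → 2 * ⌊ n /2⌋ ≤ n
2*⌊n/2⌋≤n zero          = z≤n
2*⌊n/2⌋≤n (suc zero)    = z≤n
2*⌊n/2⌋≤n (suc (suc n)) rewrite *-suc 2 ⌊ n /2⌋ = s≤s (s≤s (2*⌊n/2⌋≤n n))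

n≤1+2*⌊n/2⌋ : ∀ n → n ≤ suc (2 * ⌊ n /2⌋)
n≤1+2*⌊n/2⌋ zero          = z≤n
n≤1+2*⌊n/2⌋ (suc zero)    = s≤s z≤n
n≤1+2*⌊n/2⌋ (suc (suc n)) rewrite *-suc 2 ⌊ n /2⌋ = s≤s (s≤s (n≤1+2*⌊n/2⌋ n))

-- Stated for an arbitrary accessibility proof so that the recursion follows that of ⌊log2⌋.
2^⌊log2⌋-bounds : ∀ n (rec : Acc _<_ n) → 0 < n →
                  2 ^ ⌊log2⌋ n rec ≤ n × n < 2 ^ suc (⌊log2⌋ n rec)
2^⌊log2⌋-bounds 1             _        _ = ≤-refl , s≤s (s≤s z≤n)
2^⌊log2⌋-bounds (suc (suc k)) (acc rs) _ = lower , upper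
  where
  h = ⌊ k /2⌋
  P = 2 ^ ⌊log2⌋ (suc h) (rs (⌊n/2⌋<n (suc k)))
  ih = 2^⌊log2⌋-bounds (suc h) (rs (⌊n/2⌋<n (suc k))) (s≤s z≤n)
  lower : 2 * P ≤ 2 + k
  lower = begin
    2 * P        ≤⟨ *-monoʳ-≤ 2 (proj₁ ih) ⟩
    2 * suc h    ≡⟨ *-suc 2 h ⟩
    2 + 2 * h    ≤⟨ +-monoʳ-≤ 2 (2*⌊n/2⌋≤n k) ⟩
    2 + k        ∎
    where open ≤-Reasoning
  upper : 2 + k < 2 * (2 * P)
  upper = begin-strict
    2 + k               <⟨ s≤s (s≤s (s≤s (n≤1+2*⌊n/2⌋ k))) ⟩
    4 + 2 * h           ≡⟨ *-distribˡ-+ 2 2 h ⟨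
    2 * (2 + h)         ≤⟨ *-monoʳ-≤ 2 (proj₂ ih) ⟩
    2 * (2 * P)         ∎
    where open ≤-Reasoning

2^⌊log₂n⌋≤n<2^[1+⌊log₂n⌋] : ∀ n → 0 < n → 2 ^ ⌊log₂ n ⌋ ≤ n × n < 2 ^ suc ⌊log₂ n ⌋
2^⌊log₂n⌋≤n<2^[1+⌊log₂n⌋] n = 2^⌊log2⌋-bounds n (<-wellFounded n)

theorem13 : (n : ℕ) → n > 0 →
    let b = ⌊log₂ n ⌋
        c = n + 1 ∸ 2 ^ b
    in a 4 n ≡ 2 ^ (3 * b) + 6 * (c * c) * 2 ^ b + a 4 (c ∸ 1)
theorem13 n n>0 = begin
  a 4 n                                          ≡⟨ cong (a 4) n≡N+r ⟩
  a 4 (N + r)                                    ≡⟨ a₄[2^b+r] b r r<N ⟩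
  2 ^ (3 * b) + 6 * (suc r * suc r) * N + a 4 r  ≡⟨ cong (λ c → 2 ^ (3 * b) + 6 * (c * c) * N + a 4 (c ∸ 1)) c≡1+r ⟨
  2 ^ (3 * b) + 6 * (c * c) * N + a 4 (c ∸ 1)    ∎
  where
  open ≡-Reasoning
  b = ⌊log₂ n ⌋
  N = 2 ^ b
  r = n ∸ N
  c = n + 1 ∸ N
  N≤n = proj₁ (2^⌊log₂n⌋≤n<2^[1+⌊log₂n⌋] n n>0)
  n<2N = proj₂ (2^⌊log₂n⌋≤n<2^[1+⌊log₂n⌋] n n>0)
  n≡N+r : n ≡ N + r
  n≡N+r = sym (m+[n∸m]≡n N≤n)
  r<N : r < N
  r<N = +-cancelˡ-< N r N (subst (_< N + N) n≡N+r (subst (n <_) (cong (N +_) (+-identityʳ N)) n<2N))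
  c≡1+r : c ≡ suc r
  c≡1+r = trans (+-∸-comm 1 N≤n) (+-comm r 1)
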